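{- Let $T=(\bar v,\mathit{Init},\mathit{Tr},\mathit{Bad})$ be a transition system, let $\bar a=\{a_1,\ldots,a_n\}$ with $n\ge 1$ be an ordered set of auxiliary variables with auxiliary circuit $E(\bar v,\bar a)=\bigwedge_{i=1}^{n}(a_i\leftrightarrow l_{i_1}\star_i l_{i_2})$, let $\bar a^*=\bar a\setminus\{a_n\}$ and let $E^*(\bar v,\bar a^*)=\bigwedge_{i=1}^{n-1}(a_i\leftrightarrow l_{i_1}\star_i l_{i_2})$ be the auxiliary circuit for $\bar a^*$. If $\mathit{Inv}_1(\bar v,\bar a)$ is a generalized safe inductive invariant for $T$ with respect to $E$, then there exists a generalized safe inductive invariant $\mathit{Inv}_2(\bar v,\bar a^*)$ for $T$ with respect to $E^*$.
   Context: A transition system $T=(\bar v,\mathit{Init},\mathit{Tr},\mathit{Bad})$ consists of a finite set $\bar v$ of Boolean variables (states are valuations of $\bar v$), propositional formulas $\mathit{Init}(\bar v)$ and $\mathit{Bad}(\bar v)$ (initial and bad states), and a propositional formula $\mathit{Tr}(\bar v,\bar v')$ over $\bar v$ and a primed copy $\bar v'$ (the transition relation). An auxiliary circuit for an ordered set $\bar a=\{a_1,\ldots,a_m\}$ of fresh Boolean variables is a formula $E(\bar v,\bar a)=\bigwedge_{i=1}^{m}(a_i\leftrightarrow l_{i_1}\star_i l_{i_2})$ where $\star_i\in\{\land,\oplus\}$ ($\oplus$ = exclusive or) and $l_{i_1},l_{i_2}$ are literals over $\bar v\cup\{a_j:j<i\}$; $E(\bar v',\bar a')$ denotes its primed copy.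 A generalized safe inductive invariant with respect to $E$ is a formula $\mathit{Inv}(\bar v,\bar a)$ such that (1) $\mathit{Init}(\bar v)\land E(\bar v,\bar a)\Rightarrow \mathit{Inv}(\bar v,\bar a)$; (2) $\mathit{Inv}(\bar v,\bar a)\land E(\bar v,\bar a)\land \mathit{Tr}(\bar v,\bar v')\land E(\bar v',\bar a')\Rightarrow \mathit{Inv}(\bar v',\bar a')$; (3) $\mathit{Inv}(\bar v,\bar a)\land E(\bar v,\bar a)\Rightarrow\neg\mathit{Bad}(\bar v)$, where all implications are validities. -}

module Defs where

open import Data.Bool using (Bool; true; false; not; _∧_; _∨_; _xor_)
open import Data.Nat using (ℕ; zero; suc)
open import Data.Fin using (Fin; fromℕ; inject₁)
open import Data.Sum using (_⊎_; inj₁; inj₂; [_,_]′; map₂)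
open import Relation.Binary.PropositionalEquality using (_≡_)
open import Relation.Nullary using (¬_)

data Form (V : Set) : Set where
  const : Bool → Form V
  var   : V → Form V
  ¬f    : Form V → Form V
  _∧f_  : Form V → Form V → Form V
  _∨f_  : Form V → Form V → Form V
  _⊕f_  : Form V → Form V → Form V
  _⇔f_  : Form V → Form V → Form V

rename : {V W : Set} → (V → W) → Form V → Form W
rename f (const b) = const b
rename f (var x)   = var (f x)
rename f (¬f φ)    = ¬f (rename f φ)
rename f (φ ∧f ψ)  = rename f φ ∧f rename f ψ
rename f (φ ∨f ψ)  = rename f φ ∨f rename f ψ
rename f (φ ⊕f ψ)  = rename f φ ⊕f rename f ψ
rename f (φ ⇔f ψ)  = rename f φ ⇔f rename f ψ

_⇔b_ : Bool → Bool → Bool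
x ⇔b y = not (x xor y)

eval : {V : Set} → (V → Bool) → Form V → Bool
eval ρ (const b) = b
eval ρ (var x)   = ρ x
eval ρ (¬f φ)    = not (eval ρ φ)
eval ρ (φ ∧f ψ)  = eval ρ φ ∧ eval ρ ψ
eval ρ (φ ∨f ψ)  = eval ρ φ ∨ eval ρ ψ
eval ρ (φ ⊕f ψ)  = eval ρ φ xor eval ρ ψ
eval ρ (φ ⇔f ψ)  = eval ρ φ ⇔b eval ρ ψ

_⊨_ : {V : Set} → (V → Bool) → Form V → Set
ρ ⊨ φ = eval ρ φ ≡ true

-- Transition system over k state variables v₀ … v_{k-1}.
-- Tr is over v (inj₁) and the primed copy v' (inj₂).
record TS (k : ℕ) : Set where
  field
    Init : Form (Fin k)
    Tr   : Form (Fin k ⊎ Fin k)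
    Bad  : Form (Fin k)
open TS public

record Lit (V : Set) : Set where
  constructor lit
  field
    pos : Bool
    x   : V

litF : {V : Set} → Lit V → Form V
litF (lit true x)  = var x
litF (lit false x) = ¬f (var x)

data Op : Set where
  AND XOR : Op

-- A gate defining a_{m+1} (0-indexed: aux variable number m) from literals
-- over v ∪ {a_j : j < m}.
record Gate (k m : ℕ) : Set where
  constructor gate
  field
    op : Op
    l₁ : Lit (Fin k ⊎ Fin m)
    l₂ : Lit (Fin k ⊎ Fin m)

gateF : {k m : ℕ} → Gate k m → Form (Fin k ⊎ Fin m)
gateF (gate AND l₁ l₂) = litF l₁ ∧f litF l₂
gateF (gate XOR l₁ l₂) = litF l₁ ⊕f litF l₂

data Circuit (k : ℕ) : ℕ → Set where
  []  : Circuit k zero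
  _▷_ : {m : ℕ} → Circuit k m → Gate k m → Circuit k (suc m)

circuitF : {k m : ℕ} → Circuit k m → Form (Fin k ⊎ Fin m)
circuitF []      = const true
circuitF {k} {suc m} (C ▷ g) =
  rename (map₂ inject₁) (circuitF C)
  ∧f (var (inj₂ (fromℕ m)) ⇔f rename (map₂ inject₁) (gateF g))

record GenSafeInductiveInvariant {k m : ℕ} (T : TS k) (E : Circuit k m)
                                 (Inv : Form (Fin k ⊎ Fin m)) : Set where
  field
    initiation :
      (s : Fin k → Bool) (a : Fin m → Bool) →
      s ⊨ Init T → [ s , a ]′ ⊨ circuitF E → [ s , a ]′ ⊨ Inv
    consecution :
      (s : Fin k → Bool) (a : Fin m → Bool) (s' : Fin k → Bool) (a' : Fin m → Bool) →
      [ s , a ]′ ⊨ Inv → [ s , a ]′ ⊨ circuitF E → [ s , s' ]′ ⊨ Tr T →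
      [ s' , a' ]′ ⊨ circuitF E → [ s' , a' ]′ ⊨ Inv
    safety :
      (s : Fin k → Bool) (a : Fin m → Bool) →
      [ s , a ]′ ⊨ Inv → [ s , a ]′ ⊨ circuitF E → ¬ (s ⊨ Bad T)

{-# OPTIONS --safe #-}
module Submission where

-- The last auxiliary variable aₙ is a function of v̄ and ā*, so substituting its
-- defining gate l₁ ⋆ l₂ for aₙ in Inv₁ gives Inv₂. Every valuation of (v̄, ā*)
-- satisfying E* extends, by the value of that gate, to a valuation of (v̄, ā)
-- satisfying E, on which Inv₁ takes the value of Inv₂; the three conditions for
-- Inv₂ are thus instances of those for Inv₁.

open import Defs
open import Data.Bool using (Bool; true; not; _∧_; _∨_; _xor_)
open import Data.Bool.Properties using (xor-same)
open import Data.Fin using (Fin; zero; suc; fromℕ; inject₁)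
open import Data.Nat using (ℕ; zero; suc)
open import Data.Product using (∃; _,_)
open import Data.Sum using (_⊎_; inj₁; inj₂; [_,_]′; map₂)
open import Function using (_∘_)
open import Relation.Binary.PropositionalEquality
  using (_≡_; _≗_; refl; sym; trans; cong; cong₂; module ≡-Reasoning)

substitute : {V W : Set} → (V → Form W) → Form V → Form W
substitute σ (const b) = const b
substitute σ (var x)   = σ x
substitute σ (¬f φ)    = ¬f (substitute σ φ)
substitute σ (φ ∧f ψ)  = substitute σ φ ∧f substitute σ ψ
substitute σ (φ ∨f ψ)  = substitute σ φ ∨f substitute σ ψ
substitute σ (φ ⊕f ψ)  = substitute σ φ ⊕f substitute σ ψ
substitute σ (φ ⇔f ψ)  = substitute σ φ ⇔f substitute σ ψ

eval-substitute : {V W : Set} {ρ : W → Bool} {ρ′ : V → Bool} (σ : V → Form W) →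
                  eval ρ ∘ σ ≗ ρ′ → eval ρ ∘ substitute σ ≗ eval ρ′
eval-substitute σ eq (const b) = refl
eval-substitute σ eq (var x)   = eq x
eval-substitute σ eq (¬f φ)    = cong not (eval-substitute σ eq φ)
eval-substitute σ eq (φ ∧f ψ)  = cong₂ _∧_   (eval-substitute σ eq φ) (eval-substitute σ eq ψ)
eval-substitute σ eq (φ ∨f ψ)  = cong₂ _∨_   (eval-substitute σ eq φ) (eval-substitute σ eq ψ)
eval-substitute σ eq (φ ⊕f ψ)  = cong₂ _xor_ (eval-substitute σ eq φ) (eval-substitute σ eq ψ)
eval-substitute σ eq (φ ⇔f ψ)  = cong₂ _⇔b_  (eval-substitute σ eq φ) (eval-substitute σ eq ψ)

eval-rename : {V W : Set} {ρ : W → Bool} {ρ′ : V → Bool} (f : V → W) →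
              ρ ∘ f ≗ ρ′ → eval ρ ∘ rename f ≗ eval ρ′
eval-rename f eq (const b) = refl
eval-rename f eq (var x)   = eq x
eval-rename f eq (¬f φ)    = cong not (eval-rename f eq φ)
eval-rename f eq (φ ∧f ψ)  = cong₂ _∧_   (eval-rename f eq φ) (eval-rename f eq ψ)
eval-rename f eq (φ ∨f ψ)  = cong₂ _∨_   (eval-rename f eq φ) (eval-rename f eq ψ)
eval-rename f eq (φ ⊕f ψ)  = cong₂ _xor_ (eval-rename f eq φ) (eval-rename f eq ψ)
eval-rename f eq (φ ⇔f ψ)  = cong₂ _⇔b_  (eval-rename f eq φ) (eval-rename f eq ψ)

⇔b-refl : ∀ x → x ⇔b x ≡ true
⇔b-refl x = cong not (xor-same x)

snoc : {A : Set} {m : ℕ} → (Fin m → A) → A → Fin (suc m) → A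
snoc {m = zero}  f d zero    = d
snoc {m = suc m} f d zero    = f zero
snoc {m = suc m} f d (suc j) = snoc (f ∘ suc) d j

snoc-inject₁ : {A : Set} {m : ℕ} (f : Fin m → A) (d : A) → snoc f d ∘ inject₁ ≗ f
snoc-inject₁ {m = suc m} f d zero    = refl
snoc-inject₁ {m = suc m} f d (suc j) = snoc-inject₁ (f ∘ suc) d j

snoc-fromℕ : {A : Set} {m : ℕ} (f : Fin m → A) (d : A) → snoc f d (fromℕ m) ≡ d
snoc-fromℕ {m = zero}  f d = refl
snoc-fromℕ {m = suc m} f d = snoc-fromℕ (f ∘ suc) d

∘-snoc : {A B : Set} {m : ℕ} (h : A → B) (f : Fin m → A) (d : A) →
         h ∘ snoc f d ≗ snoc (h ∘ f) (h d)
∘-snoc {m = zero}  h f d zero    = refl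
∘-snoc {m = suc m} h f d zero    = refl
∘-snoc {m = suc m} h f d (suc j) = ∘-snoc h (f ∘ suc) d j

invariant-pullback :
  {k m n : ℕ} {T : TS k} {E : Circuit k m} {E′ : Circuit k n}
  {Inv : Form (Fin k ⊎ Fin m)} {Inv′ : Form (Fin k ⊎ Fin n)}
  (extend : (Fin k → Bool) → (Fin m → Bool) → Fin n → Bool) →
  (∀ s a → [ s , a ]′ ⊨ circuitF E → [ s , extend s a ]′ ⊨ circuitF E′) →
  (∀ s a → eval [ s , a ]′ Inv ≡ eval [ s , extend s a ]′ Inv′) →
  GenSafeInductiveInvariant T E′ Inv′ → GenSafeInductiveInvariant T E Inv
invariant-pullback extend extend-⊨ eval-Inv G = record
  { initiation  = λ s a init e →
      trans (eval-Inv s a) (G.initiation s (extend s a) init (extend-⊨ s a e))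
  ; consecution = λ s a s′ a′ inv e tr e′ →
      trans (eval-Inv s′ a′)
        (G.consecution s (extend s a) s′ (extend s′ a′)
          (trans (sym (eval-Inv s a)) inv) (extend-⊨ s a e) tr (extend-⊨ s′ a′ e′))
  ; safety      = λ s a inv e →
      G.safety s (extend s a) (trans (sym (eval-Inv s a)) inv) (extend-⊨ s a e)
  }
  where module G = GenSafeInductiveInvariant G

module LastGate {k m : ℕ} (E : Circuit k m) (g : Gate k m) where

  extend : (Fin k → Bool) → (Fin m → Bool) → Fin (suc m) → Bool
  extend s a = snoc a (eval [ s , a ]′ (gateF g))

  inline : Form (Fin k ⊎ Fin (suc m)) → Form (Fin k ⊎ Fin m)
  inline = substitute [ var ∘ inj₁ , snoc (var ∘ inj₂) (gateF g) ]′

  eval-inline : ∀ s a (φ : Form (Fin k ⊎ Fin (suc m))) →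
                eval [ s , a ]′ (inline φ) ≡ eval [ s , extend s a ]′ φ
  eval-inline s a = eval-substitute _ λ
    { (inj₁ x) → refl
    ; (inj₂ j) → ∘-snoc (eval [ s , a ]′) (var ∘ inj₂) (gateF g) j }

  extend-⊨ : ∀ s a → [ s , a ]′ ⊨ circuitF E → [ s , extend s a ]′ ⊨ circuitF (E ▷ g)
  extend-⊨ s a e = cong₂ _∧_ (trans (eval-rename _ forget (circuitF E)) e) gate-holds
    where
    open ≡-Reasoning
    forget : [ s , extend s a ]′ ∘ map₂ inject₁ ≗ [ s , a ]′
    forget (inj₁ x) = refl
    forget (inj₂ j) = snoc-inject₁ a _ j
    gate-holds : eval [ s , extend s a ]′
                   (var (inj₂ (fromℕ m)) ⇔f rename (map₂ inject₁) (gateF g)) ≡ true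
    gate-holds = begin
      extend s a (fromℕ m) ⇔b eval [ s , extend s a ]′ (rename (map₂ inject₁) (gateF g))
        ≡⟨ cong₂ _⇔b_ (snoc-fromℕ a _) (eval-rename _ forget (gateF g)) ⟩
      eval [ s , a ]′ (gateF g) ⇔b eval [ s , a ]′ (gateF g)
        ≡⟨ ⇔b-refl (eval [ s , a ]′ (gateF g)) ⟩
      true ∎

lemma3 : {k m : ℕ} (T : TS k) (Estar : Circuit k m) (g : Gate k m)
         (Inv₁ : Form (Fin k ⊎ Fin (suc m))) →
         GenSafeInductiveInvariant T (Estar ▷ g) Inv₁ →
         ∃ λ (Inv₂ : Form (Fin k ⊎ Fin m)) → GenSafeInductiveInvariant T Estar Inv₂
lemma3 T Estar g Inv₁ G =
  inline Inv₁ , invariant-pullback extend extend-⊨ (λ s a → eval-inline s a Inv₁) G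
  where open LastGate Estar g
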